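{- The quasi-orders $\preceq$ and $\preceq_r$ on states of an RPN are strongly compatible: for $\le\,\in\{\preceq,\preceq_r\}$, for all states $s,s'$ with $s\le s'$ and every firing $s\xrightarrow{(v,t)}s_1$, there exist a thread $v'$, a transition $t'$ and a firing $s'\xrightarrow{(v',t')}s'_1$ with $s_1\le s'_1$.
   Context: A Recursive Petri Net (RPN) is a tuple $\mathcal N=\langle P,T,W^+,W^-,\Omega\rangle$ where $P$ is a finite set of places, $T=T_{el}\uplus T_{ab}\uplus T_{\tau}$ is a finite set of transitions disjoint from $P$ (elementary, abstract and cut transitions), $W^-\in\mathbb N^{P\times T}$, $W^+\in\mathbb N^{P\times(T_{el}\uplus T_{ab})}$, and $\Omega:T_{ab}\to\mathbb N^P$. Write $W^{\pm}(t)\in\mathbb N^P$ for the column of $t$; markings are compared componentwise. A (concrete) state is either the empty tree $\emptyset$ or a finite rooted tree whose vertices (threads) are taken from a fixed countably infinite set $\mathcal V$, each vertex $v$ labelled by a marking $M_s(v)\in\mathbb N^P$ and each edge labelled by a vector in $\{W^+(t):t\in T_{ab}\}$. Firing rule: a thread $v$ of a state $s\neq\emptyset$ can fire $t$ if $W^-(t)\le M_s(v)$, giving $s\xrightarrow{(v,t)}s'$ where: if $t\in T_{el}$, the marking of $v$ becomes $M_s(v)-W^-(t)+W^+(t)$; if $t\in T_{ab}$, the marking of $v$ becomes $M_s(v)-W^-(t)$ and a new child $w$ of $v$ (a vertex never used before) is created with marking $\Omega(t)$ and edge $v\to w$ labelled $W^+(t)$; if $t\in T_\tau$, the subtree rooted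 at $v$ is deleted, and if $v$ is the root the result is $\emptyset$, otherwise the marking of the parent $u$ of $v$ is increased by the label of the edge $u\to v$. Quasi-orders: $\emptyset\preceq s$ for every state $s$; for $s\neq\emptyset$, $s\preceq s'$ iff there is an injective map $f$ from the vertices of $s$ to those of $s'$ such that $M_s(v)\le M_{s'}(f(v))$ for every vertex $v$ of $s$ and for every edge $v\to w$ of $s$ labelled $m$ there is an edge $f(v)\to f(w)$ of $s'$ labelled $m'\ge m$. The relation $s\preceq_r s'$ is defined in the same way with the extra requirement that $f$ maps the root of $s$ to the root of $s'$, and $\emptyset\preceq_r s$ iff $s=\emptyset$. -}

module Defs where

open import Data.Nat using (ℕ; _+_; _∸_; _≤_)
open import Data.Fin using (Fin)
open import Data.Sum using (_⊎_; inj₁; inj₂)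
open import Data.Product using (Σ; ∃; _×_; _,_; proj₁; proj₂)
open import Data.List using (List; []; _∷_; _++_; [_])
open import Data.Unit using (⊤)
open import Data.Empty using (⊥)
open import Relation.Binary.PropositionalEquality using (_≡_; refl)
open import Function.Definitions using (Injective)

-- A Recursive Petri Net.  Places are Fin nP; the three (disjoint, finite)
-- sets of transitions are Fin nEl (elementary), Fin nAb (abstract),
-- Fin nCut (cut transitions, T_τ).
record RPN : Set where
  field
    nP nEl nAb nCut : ℕ

  Marking : Set
  Marking = Fin nP → ℕ

  Transition : Set
  Transition = Fin nEl ⊎ (Fin nAb ⊎ Fin nCut)

  field
    W⁻ : Transition → Marking
    W⁺ : Fin nEl ⊎ Fin nAb → Marking
    Ω  : Fin nAb → Marking

module RPNDefs (N : RPN) where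
  open RPN N public

  _≤ᴹ_ : Marking → Marking → Set
  m ≤ᴹ m' = ∀ p → m p ≤ m' p

  _+ᴹ_ : Marking → Marking → Marking
  (m +ᴹ m') p = m p + m' p

  _∸ᴹ_ : Marking → Marking → Marking
  (m ∸ᴹ m') p = m p ∸ m' p

  Label : Set
  Label = Σ Marking (λ m → Σ (Fin nAb) (λ t → W⁺ (inj₂ t) ≡ m))

  _≤ᴸ_ : Label → Label → Set
  l ≤ᴸ l' = proj₁ l ≤ᴹ proj₁ l'

  -- non-empty states: finite rooted trees; a vertex carries its marking and
  -- its list of (edge label , subtree) children.  Vertices (threads) are
  -- identified with their positions in the tree.
  data Tree : Set where
    node : Marking → List (Label × Tree) → Tree

  Forest : Set
  Forest = List (Label × Tree)

  data State : Set where
    ∅  : State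
    tr : Tree → State

  data Pos : Tree → Set
  data PosF : Forest → Set

  data Pos where
    root : ∀ {m f} → Pos (node m f)
    down : ∀ {m f} → PosF f → Pos (node m f)

  data PosF where
    here  : ∀ {l t f} → Pos t → PosF ((l , t) ∷ f)
    there : ∀ {x f} → PosF f → PosF (x ∷ f)

  rootOf : (t : Tree) → Pos t
  rootOf (node m f) = root

  Thread : State → Set
  Thread ∅      = ⊥
  Thread (tr t) = Pos t

  markingAt  : (t : Tree) → Pos t → Marking
  markingAtF : (f : Forest) → PosF f → Marking
  markingAt (node m f) root     = m
  markingAt (node m f) (down p) = markingAtF f p
  markingAtF ((l , t) ∷ f) (here p) = markingAt t p
  markingAtF (x ∷ f) (there p)      = markingAtF f p

  data TopF : (f : Forest) → PosF f → Label → Set where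
    th : ∀ {l m' f' f} → TopF ((l , node m' f') ∷ f) (here root) l
    tt : ∀ {x f p l} → TopF f p l → TopF (x ∷ f) (there p) l

  data Child  : (t : Tree) → Pos t → Pos t → Label → Set
  data ChildF : (f : Forest) → PosF f → PosF f → Label → Set

  data Child where
    top   : ∀ {m f p l} → TopF f p l → Child (node m f) root (down p) l
    inner : ∀ {m f p q l} → ChildF f p q l → Child (node m f) (down p) (down q) l

  data ChildF where
    hereC  : ∀ {l' t f p q l} → Child t p q l → ChildF ((l' , t) ∷ f) (here p) (here q) l
    thereC : ∀ {x f p q l} → ChildF f p q l → ChildF (x ∷ f) (there p) (there q) l

  mapAt  : (t : Tree) → Pos t → (Tree → Tree) → Tree
  mapAtF : (f : Forest) → PosF f → (Tree → Tree) → Forest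
  mapAt t root g                = g t
  mapAt (node m f) (down p) g   = node m (mapAtF f p g)
  mapAtF ((l , t) ∷ f) (here p) g = (l , mapAt t p g) ∷ f
  mapAtF (x ∷ f) (there p) g      = x ∷ mapAtF f p g

  -- delete the subtree rooted at a non-root position (given as a position of
  -- the forest of children of a vertex with marking m); returns the new
  -- marking of that vertex and its new forest of children.
  cutF : Marking → (f : Forest) → PosF f → Marking × Forest
  cutF m ((l , node m' f') ∷ f) (here root) = (m +ᴹ proj₁ l) , f
  cutF m ((l , node m' f') ∷ f) (here (down p)) =
    m , ((l , node (proj₁ (cutF m' f' p)) (proj₂ (cutF m' f' p))) ∷ f)
  cutF m (x ∷ f) (there p) = proj₁ (cutF m f p) , (x ∷ proj₂ (cutF m f p))

  cutAt : (t : Tree) → Pos t → State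
  cutAt t root              = ∅
  cutAt (node m f) (down p) = tr (node (proj₁ (cutF m f p)) (proj₂ (cutF m f p)))

  abLabel : Fin nAb → Label
  abLabel a = W⁺ (inj₂ a) , a , refl

  fireResult : (s : Tree) → Pos s → Transition → State
  fireResult s v (inj₁ e) =
    tr (mapAt s v (λ { (node m f) → node ((m ∸ᴹ W⁻ (inj₁ e)) +ᴹ W⁺ (inj₁ e)) f }))
  fireResult s v (inj₂ (inj₁ a)) =
    tr (mapAt s v (λ { (node m f) →
          node (m ∸ᴹ W⁻ (inj₂ (inj₁ a))) (f ++ [ abLabel a , node (Ω a) [] ]) }))
  fireResult s v (inj₂ (inj₂ c)) = cutAt s v

  Fires : (s : State) → Thread s → Transition → State → Set
  Fires ∅ () t s₁
  Fires (tr s) v t s₁ = (W⁻ t ≤ᴹ markingAt s v) × (s₁ ≡ fireResult s v t)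

  Embeds : (s s' : Tree) → (Pos s → Pos s') → Set
  Embeds s s' f =
    Injective _≡_ _≡_ f
    × (∀ v → markingAt s v ≤ᴹ markingAt s' (f v))
    × (∀ v w l → Child s v w l → Σ Label (λ l' → Child s' (f v) (f w) l' × (l ≤ᴸ l')))

  _⪯_ : State → State → Set
  ∅ ⪯ s'         = ⊤
  tr s ⪯ ∅       = ⊥
  tr s ⪯ tr s'   = Σ (Pos s → Pos s') (λ f → Embeds s s' f)

  _⪯ᵣ_ : State → State → Set
  ∅ ⪯ᵣ s'        = s' ≡ ∅
  tr s ⪯ᵣ ∅      = ⊥
  tr s ⪯ᵣ tr s'  = Σ (Pos s → Pos s') (λ f → Embeds s s' f × (f (rootOf s) ≡ rootOf s'))

  StronglyCompatible : (State → State → Set) → Set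
  StronglyCompatible _≼_ =
    ∀ s s' → s ≼ s' → ∀ (v : Thread s) (t : Transition) (s₁ : State) → Fires s v t s₁ →
      Σ (Thread s') (λ v' → Σ Transition (λ t' → Σ State (λ s₁' →
        Fires s' v' t' s₁' × (s₁ ≼ s₁'))))

module Submission where

-- Given an embedding f of s into s′, the thread f v fires the same transition as v, since the marking of f v
-- dominates that of v; it remains to extend the embedding f to the new states.
-- An elementary firing relabels v monotonically, and an abstract one does the same
-- and then attaches a fresh leaf, which is sent to the fresh leaf attached below f v.
-- A cut at a non-root v deletes its subtree in s and the subtree of f v in s′; f sends
-- survivors to survivors because an embedding reflects the ancestor order, and the
-- parent u of v, whose marking grows by the edge label, is sent to the parent of f v,
-- whose marking grows by the (larger) label of the image edge.  A cut at the root
-- yields ∅; root-preservation is kept by all these constructions.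

open import Defs
open import Data.Product using (Σ; ∃; _×_; _,_; proj₁; proj₂)
open import Data.Sum using (_⊎_; inj₁; inj₂)
open import Data.List using ([]; _∷_; _++_; [_])
open import Data.Nat using (_≤_)
open import Data.Nat.Properties using (≤-refl; ≤-trans; +-mono-≤; ∸-monoˡ-≤; m≤m+n)
open import Data.Fin using (Fin)
open import Data.Unit using (⊤; tt)
open import Data.Empty using (⊥; ⊥-elim)
open import Function using (flip; _∘_)
open import Function.Definitions using (Injective)
open import Relation.Nullary using (Dec; yes; no; ¬_)
open import Relation.Binary.PropositionalEquality
  using (_≡_; _≢_; refl; sym; trans; cong; subst; subst₂; module ≡-Reasoning)
open import Relation.Binary.Construct.Closure.ReflexiveTransitive using (Star; ε; _◅_; _◅◅_; gmap)

module Compatibility (N : RPN) where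
  open RPNDefs N

  down-injective : ∀ {m f} {p q : PosF f} → _≡_ {A = Pos (node m f)} (down p) (down q) → p ≡ q
  down-injective refl = refl

  here-injective : ∀ {l t f} {p q : Pos t} → _≡_ {A = PosF ((l , t) ∷ f)} (here p) (here q) → p ≡ q
  here-injective refl = refl

  there-injective : ∀ {x f} {p q : PosF f} → _≡_ {A = PosF (x ∷ f)} (there p) (there q) → p ≡ q
  there-injective refl = refl

  _≟_ : {t : Tree} → (v w : Pos t) → Dec (v ≡ w)
  _≟F_ : {f : Forest} → (p q : PosF f) → Dec (p ≡ q)
  root ≟ root = yes refl
  root ≟ down _ = no λ ()
  down _ ≟ root = no λ ()
  down p ≟ down q with p ≟F q
  ... | yes refl = yes refl
  ... | no p≢q = no λ e → p≢q (down-injective e)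
  here p ≟F here q with p ≟ q
  ... | yes refl = yes refl
  ... | no p≢q = no λ e → p≢q (here-injective e)
  here _ ≟F there _ = no λ ()
  there _ ≟F here _ = no λ ()
  there p ≟F there q with p ≟F q
  ... | yes refl = yes refl
  ... | no p≢q = no λ e → p≢q (there-injective e)

  -- Ancestor order and embeddings

  _⊑_ : {t : Tree} → Pos t → Pos t → Set
  _⊑F_ : {f : Forest} → PosF f → PosF f → Set
  root ⊑ _ = ⊤
  down p ⊑ root = ⊥
  down p ⊑ down q = p ⊑F q
  here p ⊑F here q = p ⊑ q
  here _ ⊑F there _ = ⊥
  there _ ⊑F here _ = ⊥
  there p ⊑F there q = p ⊑F q

  ⊑-refl : {t : Tree} (v : Pos t) → v ⊑ v
  ⊑F-refl : {f : Forest} (p : PosF f) → p ⊑F p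
  ⊑-refl root = tt
  ⊑-refl (down p) = ⊑F-refl p
  ⊑F-refl (here p) = ⊑-refl p
  ⊑F-refl (there p) = ⊑F-refl p

  ≡⇒⊑ : {t : Tree} {v w : Pos t} → v ≡ w → v ⊑ w
  ≡⇒⊑ {v = v} refl = ⊑-refl v

  ⊑-trans : {t : Tree} {u v w : Pos t} → u ⊑ v → v ⊑ w → u ⊑ w
  ⊑F-trans : {f : Forest} {p q r : PosF f} → p ⊑F q → q ⊑F r → p ⊑F r
  ⊑-trans {u = root} _ _ = tt
  ⊑-trans {u = down p} {down q} {down r} p⊑q q⊑r = ⊑F-trans {p = p} {q} {r} p⊑q q⊑r
  ⊑F-trans {p = here u} {here v} {here w} u⊑v v⊑w = ⊑-trans {u = u} {v} {w} u⊑v v⊑w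
  ⊑F-trans {p = there p} {there q} {there r} p⊑q q⊑r = ⊑F-trans {p = p} {q} {r} p⊑q q⊑r

  ⊑-antisym : {t : Tree} {v w : Pos t} → v ⊑ w → w ⊑ v → v ≡ w
  ⊑F-antisym : {f : Forest} {p q : PosF f} → p ⊑F q → q ⊑F p → p ≡ q
  ⊑-antisym {v = root} {root} _ _ = refl
  ⊑-antisym {v = down p} {down q} p⊑q q⊑p = cong down (⊑F-antisym {p = p} {q} p⊑q q⊑p)
  ⊑F-antisym {p = here v} {here w} v⊑w w⊑v = cong here (⊑-antisym {v = v} {w} v⊑w w⊑v)
  ⊑F-antisym {p = there p} {there q} p⊑q q⊑p = cong there (⊑F-antisym {p = p} {q} p⊑q q⊑p)

  Child⇒⊑ : ∀ {t v w l} → Child t v w l → v ⊑ w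
  ChildF⇒⊑F : ∀ {f p q l} → ChildF f p q l → p ⊑F q
  Child⇒⊑ (top _) = tt
  Child⇒⊑ (inner c) = ChildF⇒⊑F c
  ChildF⇒⊑F (hereC c) = Child⇒⊑ c
  ChildF⇒⊑F (thereC c) = ChildF⇒⊑F c

  ⊑F-Top⇒≡ : ∀ {f p l} → TopF f p l → {q : PosF f} → q ⊑F p → q ≡ p
  ⊑F-Top⇒≡ th {here root} _ = refl
  ⊑F-Top⇒≡ (tt isTop) {there q} q⊑p = cong there (⊑F-Top⇒≡ isTop q⊑p)

  ⊑-Child : ∀ {t v w l} → Child t v w l → {u : Pos t} → u ⊑ w → u ⊑ v ⊎ u ≡ w
  ⊑F-ChildF : ∀ {f p q l} → ChildF f p q l → {r : PosF f} → r ⊑F q → r ⊑F p ⊎ r ≡ q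
  ⊑-Child _ {root} _ = inj₁ tt
  ⊑-Child (top isTop) {down p} p⊑q = inj₂ (cong down (⊑F-Top⇒≡ isTop p⊑q))
  ⊑-Child (inner c) {down p} p⊑q with ⊑F-ChildF c {p} p⊑q
  ... | inj₁ p⊑ = inj₁ p⊑
  ... | inj₂ refl = inj₂ refl
  ⊑F-ChildF (hereC c) {here r} r⊑q with ⊑-Child c {r} r⊑q
  ... | inj₁ r⊑ = inj₁ r⊑
  ... | inj₂ refl = inj₂ refl
  ⊑F-ChildF (thereC c) {there r} r⊑q with ⊑F-ChildF c {r} r⊑q
  ... | inj₁ r⊑ = inj₁ r⊑
  ... | inj₂ refl = inj₂ refl

  Edge : (t : Tree) → Pos t → Pos t → Set
  Edge t v w = ∃ (Child t v w)

  Up : (t : Tree) → Pos t → Pos t → Set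
  Up t = flip (Edge t)

  pathToRoot : (t : Tree) (w : Pos t) → Star (Up t) w (rootOf t)
  pathToRootF : ∀ m (f : Forest) (p : PosF f) → Star (Up (node m f)) (down p) root
  pathToRoot (node m f) root = ε
  pathToRoot (node m f) (down p) = pathToRootF m f p
  pathToRootF m ((l , t@(node _ _)) ∷ f) (here p) =
    gmap (down ∘ here) (λ { (l′ , c) → l′ , inner (hereC c) }) (pathToRoot t p) ◅◅ ((l , top th) ◅ ε)
  pathToRootF m (x ∷ f) (there p) = gmap shift (λ { (l′ , c) → l′ , shiftChild c }) (pathToRootF m f p)
    where
    shift : Pos (node m f) → Pos (node m (x ∷ f))
    shift root = root
    shift (down q) = down (there q)
    shiftChild : ∀ {v w l} → Child (node m f) v w l → Child (node m (x ∷ f)) (shift v) (shift w) l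
    shiftChild (top isTop) = top (tt isTop)
    shiftChild (inner c) = inner (thereC c)

  -- The ancestors of w are found along the path from w to the root, and
  -- each edge of that path is mapped onto an edge.
  Embeds⇒⊑-reflecting : ∀ {t t′ f} → Embeds t t′ f → ∀ v w → f v ⊑ f w → v ⊑ w
  Embeds⇒⊑-reflecting {t} {t′} {f} (f-injective , _ , f-edges) v w = along (pathToRoot t w)
    where
    image : ∀ {u w l} → Child t u w l → Edge t′ (f u) (f w)
    image c with f-edges _ _ _ c
    ... | l′ , c′ , _ = l′ , c′

    preserved : ∀ {w u} → Star (Up t) w u → f u ⊑ f w
    preserved {w} ε = ⊑-refl (f w)
    preserved {w} {u} ((_ , c) ◅ path) =
      ⊑-trans {u = f u} {f _} {f w} (preserved path) (Child⇒⊑ (proj₂ (image c)))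

    along : ∀ {w} → Star (Up t) w (rootOf t) → f v ⊑ f w → v ⊑ w
    along ε fv⊑fr = ≡⇒⊑ (f-injective (⊑-antisym {v = f v} fv⊑fr (preserved (pathToRoot t v))))
    along {w} ((_ , c) ◅ path) fv⊑fw with ⊑-Child (proj₂ (image c)) {f v} fv⊑fw
    ... | inj₁ fv⊑fu = ⊑-trans {u = v} {_} {w} (along path fv⊑fu) (Child⇒⊑ c)
    ... | inj₂ fv≡fw = ≡⇒⊑ (f-injective fv≡fw)

  -- Updating the marking of a vertex

  Monotone : (Marking → Marking) → Set
  Monotone h = ∀ {m m′} → m ≤ᴹ m′ → h m ≤ᴹ h m′

  relabel : (Marking → Marking) → Tree → Tree
  relabel h (node m f) = node (h m) f

  module Relabel (h : Marking → Marking) where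
    relabelled : (t : Tree) → Pos t → Tree
    relabelled t v = mapAt t v (relabel h)

    relabelledF : (f : Forest) → PosF f → Forest
    relabelledF f p = mapAtF f p (relabel h)

    pos : (t : Tree) (v : Pos t) → Pos t → Pos (relabelled t v)
    posF : (f : Forest) (p : PosF f) → PosF f → PosF (relabelledF f p)
    pos (node m f) root root = root
    pos (node m f) root (down q) = down q
    pos (node m f) (down p) root = root
    pos (node m f) (down p) (down q) = down (posF f p q)
    posF ((l , t) ∷ f) (here p) (here q) = here (pos t p q)
    posF ((l , t) ∷ f) (here p) (there q) = there q
    posF ((l , t) ∷ f) (there p) (here q) = here q
    posF ((l , t) ∷ f) (there p) (there q) = there (posF f p q)

    pos-surjective : (t : Tree) (v : Pos t) (x : Pos (relabelled t v)) → Σ (Pos t) (λ w → pos t v w ≡ x)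
    posF-surjective : (f : Forest) (p : PosF f) (x : PosF (relabelledF f p)) → Σ (PosF f) (λ q → posF f p q ≡ x)
    pos-surjective (node m f) root root = root , refl
    pos-surjective (node m f) root (down q) = down q , refl
    pos-surjective (node m f) (down p) root = root , refl
    pos-surjective (node m f) (down p) (down x) with posF-surjective f p x
    ... | q , refl = down q , refl
    posF-surjective ((l , t) ∷ f) (here p) (here x) with pos-surjective t p x
    ... | w , refl = here w , refl
    posF-surjective ((l , t) ∷ f) (here p) (there q) = there q , refl
    posF-surjective ((l , t) ∷ f) (there p) (here w) = here w , refl
    posF-surjective ((l , t) ∷ f) (there p) (there x) with posF-surjective f p x
    ... | q , refl = there q , refl

    pos-injective : (t : Tree) (v : Pos t) → Injective _≡_ _≡_ (pos t v)
    posF-injective : (f : Forest) (p : PosF f) → Injective _≡_ _≡_ (posF f p)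
    pos-injective (node m f) root {root} {root} _ = refl
    pos-injective (node m f) root {down _} {down _} refl = refl
    pos-injective (node m f) (down p) {root} {root} _ = refl
    pos-injective (node m f) (down p) {down _} {down _} e = cong down (posF-injective f p (down-injective e))
    posF-injective ((l , t) ∷ f) (here p) {here _} {here _} e = cong here (pos-injective t p (here-injective e))
    posF-injective ((l , t) ∷ f) (here p) {there _} {there _} refl = refl
    posF-injective ((l , t) ∷ f) (there p) {here _} {here _} refl = refl
    posF-injective ((l , t) ∷ f) (there p) {there _} {there _} e = cong there (posF-injective f p (there-injective e))

    marking-pos-self : (t : Tree) (v : Pos t) → markingAt (relabelled t v) (pos t v v) ≡ h (markingAt t v)
    markingF-posF-self : (f : Forest) (p : PosF f) → markingAtF (relabelledF f p) (posF f p p) ≡ h (markingAtF f p)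
    marking-pos-self (node m f) root = refl
    marking-pos-self (node m f) (down p) = markingF-posF-self f p
    markingF-posF-self ((l , t) ∷ f) (here p) = marking-pos-self t p
    markingF-posF-self ((l , t) ∷ f) (there p) = markingF-posF-self f p

    marking-pos-other : (t : Tree) (v w : Pos t) → w ≢ v → markingAt (relabelled t v) (pos t v w) ≡ markingAt t w
    markingF-posF-other : (f : Forest) (p q : PosF f) → q ≢ p →
      markingAtF (relabelledF f p) (posF f p q) ≡ markingAtF f q
    marking-pos-other (node m f) root root w≢v = ⊥-elim (w≢v refl)
    marking-pos-other (node m f) root (down q) _ = refl
    marking-pos-other (node m f) (down p) root _ = refl
    marking-pos-other (node m f) (down p) (down q) w≢v = markingF-posF-other f p q (w≢v ∘ cong down)
    markingF-posF-other ((l , t) ∷ f) (here p) (here w) q≢p = marking-pos-other t p w (q≢p ∘ cong here)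
    markingF-posF-other ((l , t) ∷ f) (here p) (there q) _ = refl
    markingF-posF-other ((l , t) ∷ f) (there p) (here w) _ = refl
    markingF-posF-other ((l , t) ∷ f) (there p) (there q) q≢p = markingF-posF-other f p q (q≢p ∘ cong there)

    TopF-posF : (f : Forest) (p q : PosF f) {l : Label} → TopF f q l → TopF (relabelledF f p) (posF f p q) l
    TopF-posF ((l , node _ _) ∷ f) (here root) (here root) th = th
    TopF-posF ((l , node _ _) ∷ f) (here (down p)) (here root) th = th
    TopF-posF ((l , node _ _) ∷ f) (there p) (here root) th = th
    TopF-posF ((l , t) ∷ f) (here p) (there q) (tt isTop) = tt isTop
    TopF-posF ((l , t) ∷ f) (there p) (there q) (tt isTop) = tt (TopF-posF f p q isTop)

    Child-pos : (t : Tree) (v u w : Pos t) {l : Label} → Child t u w l →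
      Child (relabelled t v) (pos t v u) (pos t v w) l
    ChildF-posF : (f : Forest) (p q r : PosF f) {l : Label} → ChildF f q r l →
      ChildF (relabelledF f p) (posF f p q) (posF f p r) l
    Child-pos (node m f) root root (down q) (top isTop) = top isTop
    Child-pos (node m f) root (down q) (down r) (inner c) = inner c
    Child-pos (node m f) (down p) root (down q) (top isTop) = top (TopF-posF f p q isTop)
    Child-pos (node m f) (down p) (down q) (down r) (inner c) = inner (ChildF-posF f p q r c)
    ChildF-posF ((l , t) ∷ f) (here p) (here u) (here w) (hereC c) = hereC (Child-pos t p u w c)
    ChildF-posF ((l , t) ∷ f) (here p) (there q) (there r) (thereC c) = thereC c
    ChildF-posF ((l , t) ∷ f) (there p) (here u) (here w) (hereC c) = hereC c
    ChildF-posF ((l , t) ∷ f) (there p) (there q) (there r) (thereC c) = thereC (ChildF-posF f p q r c)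

    TopF-posF⁻¹ : (f : Forest) (p q : PosF f) {l : Label} → TopF (relabelledF f p) (posF f p q) l → TopF f q l
    TopF-posF⁻¹ ((l , node _ _) ∷ f) (here root) (here root) th = th
    TopF-posF⁻¹ ((l , node _ _) ∷ f) (here (down p)) (here root) th = th
    TopF-posF⁻¹ ((l , node _ _) ∷ f) (there p) (here q) th = th
    TopF-posF⁻¹ ((l , t) ∷ f) (here p) (there q) (tt isTop) = tt isTop
    TopF-posF⁻¹ ((l , t) ∷ f) (there p) (there q) (tt isTop) = tt (TopF-posF⁻¹ f p q isTop)

    Child-pos⁻¹ : (t : Tree) (v u w : Pos t) {l : Label} → Child (relabelled t v) (pos t v u) (pos t v w) l →
      Child t u w l
    ChildF-posF⁻¹ : (f : Forest) (p q r : PosF f) {l : Label} →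
      ChildF (relabelledF f p) (posF f p q) (posF f p r) l → ChildF f q r l
    Child-pos⁻¹ (node m f) root root (down q) (top isTop) = top isTop
    Child-pos⁻¹ (node m f) root (down q) (down r) (inner c) = inner c
    Child-pos⁻¹ (node m f) (down p) root (down q) (top isTop) = top (TopF-posF⁻¹ f p q isTop)
    Child-pos⁻¹ (node m f) (down p) (down q) (down r) (inner c) = inner (ChildF-posF⁻¹ f p q r c)
    ChildF-posF⁻¹ ((l , t) ∷ f) (here p) (here u) (here w) (hereC c) = hereC (Child-pos⁻¹ t p u w c)
    ChildF-posF⁻¹ ((l , t) ∷ f) (here p) (there q) (there r) (thereC c) = thereC c
    ChildF-posF⁻¹ ((l , t) ∷ f) (there p) (here u) (here w) (hereC c) = hereC c
    ChildF-posF⁻¹ ((l , t) ∷ f) (there p) (there q) (there r) (thereC c) = thereC (ChildF-posF⁻¹ f p q r c)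

    pos-rootOf : (t : Tree) (v : Pos t) → pos t v (rootOf t) ≡ rootOf (relabelled t v)
    pos-rootOf (node m f) root = refl
    pos-rootOf (node m f) (down p) = refl

    mapAt-∘-relabel : ∀ g t v → mapAt t v (g ∘ relabel h) ≡ mapAt (relabelled t v) (pos t v v) g
    mapAtF-∘-relabel : ∀ g f p → mapAtF f p (g ∘ relabel h) ≡ mapAtF (relabelledF f p) (posF f p p) g
    mapAt-∘-relabel g (node m f) root = refl
    mapAt-∘-relabel g (node m f) (down p) = cong (node m) (mapAtF-∘-relabel g f p)
    mapAtF-∘-relabel g ((l , t) ∷ f) (here p) = cong (λ t′ → (l , t′) ∷ f) (mapAt-∘-relabel g t p)
    mapAtF-∘-relabel g (x ∷ f) (there p) = cong (x ∷_) (mapAtF-∘-relabel g f p)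

    module Embedding (h-monotone : Monotone h) {t t′ : Tree} {f : Pos t → Pos t′} (emb : Embeds t t′ f) (v : Pos t) where
      private
        f-injective : Injective _≡_ _≡_ f
        f-injective = proj₁ emb

      map : Pos (relabelled t v) → Pos (relabelled t′ (f v))
      map x = pos t′ (f v) (f (proj₁ (pos-surjective t v x)))

      map-pos : ∀ w → map (pos t v w) ≡ pos t′ (f v) (f w)
      map-pos w = cong (pos t′ (f v) ∘ f) (pos-injective t v (proj₂ (pos-surjective t v (pos t v w))))

      map-embeds : Embeds (relabelled t v) (relabelled t′ (f v)) map
      map-embeds = injective , marking-≤ , edges
        where
        injective : Injective _≡_ _≡_ map
        injective {x} {y} e with pos-surjective t v x | pos-surjective t v y
        ... | u , refl | w , refl = cong (pos t v) (f-injective (pos-injective t′ (f v) e))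

        marking-≤ : ∀ x → markingAt (relabelled t v) x ≤ᴹ markingAt (relabelled t′ (f v)) (map x)
        marking-≤ x with pos-surjective t v x
        ... | w , refl with w ≟ v
        ... | yes refl rewrite marking-pos-self t v | marking-pos-self t′ (f v) = h-monotone (proj₁ (proj₂ emb) v)
        ... | no w≢v rewrite marking-pos-other t v w w≢v | marking-pos-other t′ (f v) (f w) (w≢v ∘ f-injective) =
          proj₁ (proj₂ emb) w

        edges : ∀ x y l → Child (relabelled t v) x y l →
          Σ Label (λ l′ → Child (relabelled t′ (f v)) (map x) (map y) l′ × (l ≤ᴸ l′))
        edges x y l c with pos-surjective t v x | pos-surjective t v y
        ... | u , refl | w , refl with proj₂ (proj₂ emb) u w l (Child-pos⁻¹ t v u w c)
        ... | l′ , c′ , l≤l′ = l′ , Child-pos t′ (f v) (f u) (f w) c′ , l≤l′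

      map-rootOf : f (rootOf t) ≡ rootOf t′ → map (rootOf (relabelled t v)) ≡ rootOf (relabelled t′ (f v))
      map-rootOf f-root = begin
        map (rootOf (relabelled t v))    ≡⟨ cong map (sym (pos-rootOf t v)) ⟩
        map (pos t v (rootOf t))         ≡⟨ map-pos (rootOf t) ⟩
        pos t′ (f v) (f (rootOf t))      ≡⟨ cong (pos t′ (f v)) f-root ⟩
        pos t′ (f v) (rootOf t′)         ≡⟨ pos-rootOf t′ (f v) ⟩
        rootOf (relabelled t′ (f v))     ∎
        where open ≡-Reasoning

  -- Attaching a leaf

  sprout : Label → Marking → Tree → Tree
  sprout l m₀ (node m f) = node m (f ++ [ l , node m₀ [] ])

  module Sprout (l₀ : Label) (m₀ : Marking) where
    private
      leaf : Label × Tree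
      leaf = l₀ , node m₀ []

    sprouted : (t : Tree) → Pos t → Tree
    sprouted t v = mapAt t v (sprout l₀ m₀)

    sproutedF : (f : Forest) → PosF f → Forest
    sproutedF f p = mapAtF f p (sprout l₀ m₀)

    old : (f : Forest) → PosF f → PosF (f ++ [ leaf ])
    old ((l , t) ∷ f) (here p) = here p
    old ((l , t) ∷ f) (there q) = there (old f q)

    last : (f : Forest) → PosF (f ++ [ leaf ])
    last [] = here root
    last (_ ∷ f) = there (last f)

    old-or-last : (f : Forest) (q : PosF (f ++ [ leaf ])) → Σ (PosF f) (λ q′ → old f q′ ≡ q) ⊎ last f ≡ q
    old-or-last [] (here root) = inj₂ refl
    old-or-last ((l , t) ∷ f) (here q) = inj₁ (here q , refl)
    old-or-last ((l , t) ∷ f) (there q) with old-or-last f q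
    ... | inj₁ (q′ , refl) = inj₁ (there q′ , refl)
    ... | inj₂ refl = inj₂ refl

    old-injective : (f : Forest) → Injective _≡_ _≡_ (old f)
    old-injective ((l , t) ∷ f) {here _} {here _} refl = refl
    old-injective ((l , t) ∷ f) {there _} {there _} e = cong there (old-injective f (there-injective e))

    old≢last : (f : Forest) (q : PosF f) → old f q ≢ last f
    old≢last ((l , t) ∷ f) (there q) e = old≢last f q (there-injective e)

    marking-old : (f : Forest) (q : PosF f) → markingAtF (f ++ [ leaf ]) (old f q) ≡ markingAtF f q
    marking-old ((l , t) ∷ f) (here p) = refl
    marking-old ((l , t) ∷ f) (there q) = marking-old f q

    marking-last : (f : Forest) → markingAtF (f ++ [ leaf ]) (last f) ≡ m₀
    marking-last [] = refl
    marking-last (_ ∷ f) = marking-last f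

    TopF-old : (f : Forest) (q : PosF f) {l : Label} → TopF f q l → TopF (f ++ [ leaf ]) (old f q) l
    TopF-old ((l , node _ _) ∷ f) (here root) th = th
    TopF-old ((l , t) ∷ f) (there q) (tt isTop) = tt (TopF-old f q isTop)

    TopF-old⁻¹ : (f : Forest) (q : PosF f) {l : Label} → TopF (f ++ [ leaf ]) (old f q) l → TopF f q l
    TopF-old⁻¹ ((l , node _ _) ∷ f) (here root) th = th
    TopF-old⁻¹ ((l , t) ∷ f) (there q) (tt isTop) = tt (TopF-old⁻¹ f q isTop)

    TopF-last : (f : Forest) → TopF (f ++ [ leaf ]) (last f) l₀
    TopF-last [] = th
    TopF-last (_ ∷ f) = tt (TopF-last f)

    TopF-last⁻¹ : (f : Forest) {l : Label} → TopF (f ++ [ leaf ]) (last f) l → l ≡ l₀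
    TopF-last⁻¹ [] th = refl
    TopF-last⁻¹ (_ ∷ f) (tt isTop) = TopF-last⁻¹ f isTop

    ChildF-old : (f : Forest) (q r : PosF f) {l : Label} → ChildF f q r l → ChildF (f ++ [ leaf ]) (old f q) (old f r) l
    ChildF-old ((l , t) ∷ f) (here _) (here _) (hereC c) = hereC c
    ChildF-old ((l , t) ∷ f) (there q) (there r) (thereC c) = thereC (ChildF-old f q r c)

    ChildF-old⁻¹ : (f : Forest) (q r : PosF f) {l : Label} → ChildF (f ++ [ leaf ]) (old f q) (old f r) l →
      ChildF f q r l
    ChildF-old⁻¹ ((l , t) ∷ f) (here _) (here _) (hereC c) = hereC c
    ChildF-old⁻¹ ((l , t) ∷ f) (there q) (there r) (thereC c) = thereC (ChildF-old⁻¹ f q r c)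

    ¬ChildF-old-last : (f : Forest) (q : PosF f) {l : Label} → ¬ ChildF (f ++ [ leaf ]) (old f q) (last f) l
    ¬ChildF-old-last ((l , t) ∷ f) (there q) (thereC c) = ¬ChildF-old-last f q c

    ¬ChildF-last : (f : Forest) (r : PosF (f ++ [ leaf ])) {l : Label} → ¬ ChildF (f ++ [ leaf ]) (last f) r l
    ¬ChildF-last [] (here _) (hereC (top ()))
    ¬ChildF-last (_ ∷ f) (there r) (thereC c) = ¬ChildF-last f r c

    pos : (t : Tree) (v : Pos t) → Pos t → Pos (sprouted t v)
    posF : (f : Forest) (p : PosF f) → PosF f → PosF (sproutedF f p)
    pos (node m f) root root = root
    pos (node m f) root (down q) = down (old f q)
    pos (node m f) (down p) root = root
    pos (node m f) (down p) (down q) = down (posF f p q)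
    posF ((l , t) ∷ f) (here p) (here q) = here (pos t p q)
    posF ((l , t) ∷ f) (here p) (there q) = there q
    posF ((l , t) ∷ f) (there p) (here q) = here q
    posF ((l , t) ∷ f) (there p) (there q) = there (posF f p q)

    new : (t : Tree) (v : Pos t) → Pos (sprouted t v)
    newF : (f : Forest) (p : PosF f) → PosF (sproutedF f p)
    new (node m f) root = down (last f)
    new (node m f) (down p) = down (newF f p)
    newF ((l , t) ∷ f) (here p) = here (new t p)
    newF ((l , t) ∷ f) (there p) = there (newF f p)

    pos-or-new : (t : Tree) (v : Pos t) (x : Pos (sprouted t v)) → Σ (Pos t) (λ w → pos t v w ≡ x) ⊎ new t v ≡ x
    posF-or-newF : (f : Forest) (p : PosF f) (x : PosF (sproutedF f p)) →
      Σ (PosF f) (λ q → posF f p q ≡ x) ⊎ newF f p ≡ x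
    pos-or-new (node m f) root root = inj₁ (root , refl)
    pos-or-new (node m f) root (down x) with old-or-last f x
    ... | inj₁ (q , refl) = inj₁ (down q , refl)
    ... | inj₂ refl = inj₂ refl
    pos-or-new (node m f) (down p) root = inj₁ (root , refl)
    pos-or-new (node m f) (down p) (down x) with posF-or-newF f p x
    ... | inj₁ (q , refl) = inj₁ (down q , refl)
    ... | inj₂ refl = inj₂ refl
    posF-or-newF ((l , t) ∷ f) (here p) (here x) with pos-or-new t p x
    ... | inj₁ (w , refl) = inj₁ (here w , refl)
    ... | inj₂ refl = inj₂ refl
    posF-or-newF ((l , t) ∷ f) (here p) (there q) = inj₁ (there q , refl)
    posF-or-newF ((l , t) ∷ f) (there p) (here w) = inj₁ (here w , refl)
    posF-or-newF ((l , t) ∷ f) (there p) (there x) with posF-or-newF f p x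
    ... | inj₁ (q , refl) = inj₁ (there q , refl)
    ... | inj₂ refl = inj₂ refl

    pos-injective : (t : Tree) (v : Pos t) → Injective _≡_ _≡_ (pos t v)
    posF-injective : (f : Forest) (p : PosF f) → Injective _≡_ _≡_ (posF f p)
    pos-injective (node m f) root {root} {root} _ = refl
    pos-injective (node m f) root {down _} {down _} e = cong down (old-injective f (down-injective e))
    pos-injective (node m f) (down p) {root} {root} _ = refl
    pos-injective (node m f) (down p) {down _} {down _} e = cong down (posF-injective f p (down-injective e))
    posF-injective ((l , t) ∷ f) (here p) {here _} {here _} e = cong here (pos-injective t p (here-injective e))
    posF-injective ((l , t) ∷ f) (here p) {there _} {there _} refl = refl
    posF-injective ((l , t) ∷ f) (there p) {here _} {here _} refl = refl
    posF-injective ((l , t) ∷ f) (there p) {there _} {there _} e = cong there (posF-injective f p (there-injective e))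

    pos≢new : (t : Tree) (v w : Pos t) → pos t v w ≢ new t v
    posF≢newF : (f : Forest) (p q : PosF f) → posF f p q ≢ newF f p
    pos≢new (node m f) root (down q) e = old≢last f q (down-injective e)
    pos≢new (node m f) (down p) (down q) e = posF≢newF f p q (down-injective e)
    posF≢newF ((l , t) ∷ f) (here p) (here w) e = pos≢new t p w (here-injective e)
    posF≢newF ((l , t) ∷ f) (there p) (there q) e = posF≢newF f p q (there-injective e)

    marking-pos : (t : Tree) (v w : Pos t) → markingAt (sprouted t v) (pos t v w) ≡ markingAt t w
    markingF-posF : (f : Forest) (p q : PosF f) → markingAtF (sproutedF f p) (posF f p q) ≡ markingAtF f q
    marking-pos (node m f) root root = refl
    marking-pos (node m f) root (down q) = marking-old f q
    marking-pos (node m f) (down p) root = refl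
    marking-pos (node m f) (down p) (down q) = markingF-posF f p q
    markingF-posF ((l , t) ∷ f) (here p) (here w) = marking-pos t p w
    markingF-posF ((l , t) ∷ f) (here p) (there q) = refl
    markingF-posF ((l , t) ∷ f) (there p) (here w) = refl
    markingF-posF ((l , t) ∷ f) (there p) (there q) = markingF-posF f p q

    marking-new : (t : Tree) (v : Pos t) → markingAt (sprouted t v) (new t v) ≡ m₀
    markingF-newF : (f : Forest) (p : PosF f) → markingAtF (sproutedF f p) (newF f p) ≡ m₀
    marking-new (node m f) root = marking-last f
    marking-new (node m f) (down p) = markingF-newF f p
    markingF-newF ((l , t) ∷ f) (here p) = marking-new t p
    markingF-newF ((l , t) ∷ f) (there p) = markingF-newF f p

    TopF-posF : (f : Forest) (p q : PosF f) {l : Label} → TopF f q l → TopF (sproutedF f p) (posF f p q) l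
    TopF-posF ((l , node _ _) ∷ f) (here root) (here root) th = th
    TopF-posF ((l , node _ _) ∷ f) (here (down p)) (here root) th = th
    TopF-posF ((l , node _ _) ∷ f) (there p) (here root) th = th
    TopF-posF ((l , t) ∷ f) (here p) (there q) (tt isTop) = tt isTop
    TopF-posF ((l , t) ∷ f) (there p) (there q) (tt isTop) = tt (TopF-posF f p q isTop)

    Child-pos : (t : Tree) (v u w : Pos t) {l : Label} → Child t u w l → Child (sprouted t v) (pos t v u) (pos t v w) l
    ChildF-posF : (f : Forest) (p q r : PosF f) {l : Label} → ChildF f q r l →
      ChildF (sproutedF f p) (posF f p q) (posF f p r) l
    Child-pos (node m f) root root (down q) (top isTop) = top (TopF-old f q isTop)
    Child-pos (node m f) root (down q) (down r) (inner c) = inner (ChildF-old f q r c)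
    Child-pos (node m f) (down p) root (down q) (top isTop) = top (TopF-posF f p q isTop)
    Child-pos (node m f) (down p) (down q) (down r) (inner c) = inner (ChildF-posF f p q r c)
    ChildF-posF ((l , t) ∷ f) (here p) (here u) (here w) (hereC c) = hereC (Child-pos t p u w c)
    ChildF-posF ((l , t) ∷ f) (here p) (there q) (there r) (thereC c) = thereC c
    ChildF-posF ((l , t) ∷ f) (there p) (here u) (here w) (hereC c) = hereC c
    ChildF-posF ((l , t) ∷ f) (there p) (there q) (there r) (thereC c) = thereC (ChildF-posF f p q r c)

    TopF-posF⁻¹ : (f : Forest) (p q : PosF f) {l : Label} → TopF (sproutedF f p) (posF f p q) l → TopF f q l
    TopF-posF⁻¹ ((l , node _ _) ∷ f) (here root) (here root) th = th
    TopF-posF⁻¹ ((l , node _ _) ∷ f) (here (down p)) (here root) th = th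
    TopF-posF⁻¹ ((l , node _ _) ∷ f) (there p) (here q) th = th
    TopF-posF⁻¹ ((l , t) ∷ f) (here p) (there q) (tt isTop) = tt isTop
    TopF-posF⁻¹ ((l , t) ∷ f) (there p) (there q) (tt isTop) = tt (TopF-posF⁻¹ f p q isTop)

    Child-pos⁻¹ : (t : Tree) (v u w : Pos t) {l : Label} → Child (sprouted t v) (pos t v u) (pos t v w) l →
      Child t u w l
    ChildF-posF⁻¹ : (f : Forest) (p q r : PosF f) {l : Label} →
      ChildF (sproutedF f p) (posF f p q) (posF f p r) l → ChildF f q r l
    Child-pos⁻¹ (node m f) root root (down q) (top isTop) = top (TopF-old⁻¹ f q isTop)
    Child-pos⁻¹ (node m f) root (down q) (down r) (inner c) = inner (ChildF-old⁻¹ f q r c)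
    Child-pos⁻¹ (node m f) (down p) root (down q) (top isTop) = top (TopF-posF⁻¹ f p q isTop)
    Child-pos⁻¹ (node m f) (down p) (down q) (down r) (inner c) = inner (ChildF-posF⁻¹ f p q r c)
    ChildF-posF⁻¹ ((l , t) ∷ f) (here p) (here u) (here w) (hereC c) = hereC (Child-pos⁻¹ t p u w c)
    ChildF-posF⁻¹ ((l , t) ∷ f) (here p) (there q) (there r) (thereC c) = thereC c
    ChildF-posF⁻¹ ((l , t) ∷ f) (there p) (here u) (here w) (hereC c) = hereC c
    ChildF-posF⁻¹ ((l , t) ∷ f) (there p) (there q) (there r) (thereC c) = thereC (ChildF-posF⁻¹ f p q r c)

    Child-new : (t : Tree) (v : Pos t) → Child (sprouted t v) (pos t v v) (new t v) l₀
    ChildF-newF : (f : Forest) (p : PosF f) → ChildF (sproutedF f p) (posF f p p) (newF f p) l₀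
    Child-new (node m f) root = top (TopF-last f)
    Child-new (node m f) (down p) = inner (ChildF-newF f p)
    ChildF-newF ((l , t) ∷ f) (here p) = hereC (Child-new t p)
    ChildF-newF ((l , t) ∷ f) (there p) = thereC (ChildF-newF f p)

    ¬TopF-newF : (f : Forest) (p : PosF f) {l : Label} → ¬ TopF (sproutedF f p) (newF f p) l
    ¬TopF-newF ((l , node _ _) ∷ f) (here root) ()
    ¬TopF-newF ((l , node _ _) ∷ f) (here (down p)) ()
    ¬TopF-newF ((l , t) ∷ f) (there p) (tt isTop) = ¬TopF-newF f p isTop

    Child-new⁻¹ : (t : Tree) (v u : Pos t) {l : Label} → Child (sprouted t v) (pos t v u) (new t v) l → u ≡ v × l ≡ l₀
    ChildF-newF⁻¹ : (f : Forest) (p q : PosF f) {l : Label} → ChildF (sproutedF f p) (posF f p q) (newF f p) l →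
      q ≡ p × l ≡ l₀
    Child-new⁻¹ (node m f) root root (top isTop) = refl , TopF-last⁻¹ f isTop
    Child-new⁻¹ (node m f) root (down q) (inner c) = ⊥-elim (¬ChildF-old-last f q c)
    Child-new⁻¹ (node m f) (down p) root (top isTop) = ⊥-elim (¬TopF-newF f p isTop)
    Child-new⁻¹ (node m f) (down p) (down q) (inner c) with ChildF-newF⁻¹ f p q c
    ... | refl , l≡l₀ = refl , l≡l₀
    ChildF-newF⁻¹ ((l , t) ∷ f) (here p) (here w) (hereC c) with Child-new⁻¹ t p w c
    ... | refl , l≡l₀ = refl , l≡l₀
    ChildF-newF⁻¹ ((l , t) ∷ f) (there p) (there q) (thereC c) with ChildF-newF⁻¹ f p q c
    ... | refl , l≡l₀ = refl , l≡l₀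

    ¬Child-new : (t : Tree) (v : Pos t) {x : Pos (sprouted t v)} {l : Label} → ¬ Child (sprouted t v) (new t v) x l
    ¬ChildF-newF : (f : Forest) (p : PosF f) {q : PosF (sproutedF f p)} {l : Label} →
      ¬ ChildF (sproutedF f p) (newF f p) q l
    ¬Child-new (node m f) root {down q} (inner c) = ¬ChildF-last f q c
    ¬Child-new (node m f) (down p) {down q} (inner c) = ¬ChildF-newF f p c
    ¬ChildF-newF ((l , t) ∷ f) (here p) (hereC c) = ¬Child-new t p c
    ¬ChildF-newF ((l , t) ∷ f) (there p) (thereC c) = ¬ChildF-newF f p c

    pos-rootOf : (t : Tree) (v : Pos t) → pos t v (rootOf t) ≡ rootOf (sprouted t v)
    pos-rootOf (node m f) root = refl
    pos-rootOf (node m f) (down p) = refl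

    module Embedding {t t′ : Tree} {f : Pos t → Pos t′} (emb : Embeds t t′ f) (v : Pos t) where
      private
        f-injective : Injective _≡_ _≡_ f
        f-injective = proj₁ emb

        image : ∀ {x} → Σ (Pos t) (λ w → pos t v w ≡ x) ⊎ new t v ≡ x → Pos (sprouted t′ (f v))
        image (inj₁ (w , _)) = pos t′ (f v) (f w)
        image (inj₂ _) = new t′ (f v)

      map : Pos (sprouted t v) → Pos (sprouted t′ (f v))
      map x = image (pos-or-new t v x)

      map-pos : ∀ w → map (pos t v w) ≡ pos t′ (f v) (f w)
      map-pos w with pos-or-new t v (pos t v w)
      ... | inj₁ (u , e) = cong (pos t′ (f v) ∘ f) (pos-injective t v e)
      ... | inj₂ e = ⊥-elim (pos≢new t v w (sym e))

      map-embeds : Embeds (sprouted t v) (sprouted t′ (f v)) map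
      map-embeds = injective , marking-≤ , edges
        where
        injective : Injective _≡_ _≡_ map
        injective {x} {y} e with pos-or-new t v x | pos-or-new t v y
        ... | inj₁ (u , refl) | inj₁ (w , refl) = cong (pos t v) (f-injective (pos-injective t′ (f v) e))
        ... | inj₁ (u , refl) | inj₂ refl = ⊥-elim (pos≢new t′ (f v) (f u) e)
        ... | inj₂ refl | inj₁ (w , refl) = ⊥-elim (pos≢new t′ (f v) (f w) (sym e))
        ... | inj₂ refl | inj₂ refl = refl

        marking-≤ : ∀ x → markingAt (sprouted t v) x ≤ᴹ markingAt (sprouted t′ (f v)) (map x)
        marking-≤ x with pos-or-new t v x
        ... | inj₁ (w , refl) rewrite marking-pos t v w | marking-pos t′ (f v) (f w) = proj₁ (proj₂ emb) w
        ... | inj₂ refl rewrite marking-new t v | marking-new t′ (f v) = λ _ → ≤-refl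

        edges : ∀ x y l → Child (sprouted t v) x y l →
          Σ Label (λ l′ → Child (sprouted t′ (f v)) (map x) (map y) l′ × (l ≤ᴸ l′))
        edges x y l c with pos-or-new t v x | pos-or-new t v y
        ... | inj₂ refl | _ = ⊥-elim (¬Child-new t v c)
        ... | inj₁ (u , refl) | inj₁ (w , refl) with proj₂ (proj₂ emb) u w l (Child-pos⁻¹ t v u w c)
        ... | l′ , c′ , l≤l′ = l′ , Child-pos t′ (f v) (f u) (f w) c′ , l≤l′
        edges x y l c | inj₁ (u , refl) | inj₂ refl with Child-new⁻¹ t v u c
        ... | refl , refl = l₀ , Child-new t′ (f v) , λ _ → ≤-refl

      map-rootOf : f (rootOf t) ≡ rootOf t′ → map (rootOf (sprouted t v)) ≡ rootOf (sprouted t′ (f v))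
      map-rootOf f-root = begin
        map (rootOf (sprouted t v))    ≡⟨ cong map (sym (pos-rootOf t v)) ⟩
        map (pos t v (rootOf t))       ≡⟨ map-pos (rootOf t) ⟩
        pos t′ (f v) (f (rootOf t))    ≡⟨ cong (pos t′ (f v)) f-root ⟩
        pos t′ (f v) (rootOf t′)       ≡⟨ pos-rootOf t′ (f v) ⟩
        rootOf (sprouted t′ (f v))     ∎
        where open ≡-Reasoning

  -- Cutting a subtree

  cutForest : Marking → (f : Forest) → PosF f → Forest
  cutForest m f p = proj₂ (cutF m f p)

  cutTree : Marking → (f : Forest) → PosF f → Tree
  cutTree m f p = node (proj₁ (cutF m f p)) (cutForest m f p)

  origin : ∀ m f (p : PosF f) → Pos (cutTree m f p) → Pos (node m f)
  originF : ∀ m f (p : PosF f) → PosF (cutForest m f p) → PosF f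
  origin m f p root = root
  origin m f p (down q) = down (originF m f p q)
  originF m ((l , node _ _) ∷ f) (here root) q = there q
  originF m ((l , node m′ f′) ∷ f) (here (down p)) (here x) = here (origin m′ f′ p x)
  originF m ((l , node _ _) ∷ f) (here (down p)) (there q) = there q
  originF m ((l , node _ _) ∷ f) (there p) (here x) = here x
  originF m ((l , node _ _) ∷ f) (there p) (there q) = there (originF m f p q)

  origin-injective : ∀ m f (p : PosF f) → Injective _≡_ _≡_ (origin m f p)
  originF-injective : ∀ m f (p : PosF f) → Injective _≡_ _≡_ (originF m f p)
  origin-injective m f p {root} {root} _ = refl
  origin-injective m f p {down _} {down _} e = cong down (originF-injective m f p (down-injective e))
  originF-injective m ((l , node _ _) ∷ f) (here root) e = there-injective e
  originF-injective m ((l , node m′ f′) ∷ f) (here (down p)) {here _} {here _} e =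
    cong here (origin-injective m′ f′ p (here-injective e))
  originF-injective m ((l , node _ _) ∷ f) (here (down p)) {there _} {there _} refl = refl
  originF-injective m ((l , node _ _) ∷ f) (there p) {here _} {here _} refl = refl
  originF-injective m ((l , node _ _) ∷ f) (there p) {there _} {there _} e =
    cong there (originF-injective m f p (there-injective e))

  ⊒⊎origin : ∀ m f (p : PosF f) (w : Pos (node m f)) → down p ⊑ w ⊎ Σ (Pos (cutTree m f p)) (λ x → origin m f p x ≡ w)
  ⊒F⊎originF : ∀ m f (p : PosF f) (q : PosF f) → p ⊑F q ⊎ Σ (PosF (cutForest m f p)) (λ x → originF m f p x ≡ q)
  ⊒⊎origin m f p root = inj₂ (root , refl)
  ⊒⊎origin m f p (down q) with ⊒F⊎originF m f p q
  ... | inj₁ p⊑q = inj₁ p⊑q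
  ... | inj₂ (x , refl) = inj₂ (down x , refl)
  ⊒F⊎originF m ((l , node _ _) ∷ f) (here root) (here _) = inj₁ tt
  ⊒F⊎originF m ((l , node _ _) ∷ f) (here root) (there q) = inj₂ (q , refl)
  ⊒F⊎originF m ((l , node m′ f′) ∷ f) (here (down p)) (here w) with ⊒⊎origin m′ f′ p w
  ... | inj₁ p⊑w = inj₁ p⊑w
  ... | inj₂ (x , refl) = inj₂ (here x , refl)
  ⊒F⊎originF m ((l , node _ _) ∷ f) (here (down p)) (there q) = inj₂ (there q , refl)
  ⊒F⊎originF m ((l , node _ _) ∷ f) (there p) (here w) = inj₂ (here w , refl)
  ⊒F⊎originF m ((l , node _ _) ∷ f) (there p) (there q) with ⊒F⊎originF m f p q
  ... | inj₁ p⊑q = inj₁ p⊑q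
  ... | inj₂ (x , refl) = inj₂ (there x , refl)

  ¬⊑origin : ∀ m f (p : PosF f) (x : Pos (cutTree m f p)) → ¬ down p ⊑ origin m f p x
  ¬⊑ForiginF : ∀ m f (p : PosF f) (q : PosF (cutForest m f p)) → ¬ p ⊑F originF m f p q
  ¬⊑origin m f p root ()
  ¬⊑origin m f p (down q) = ¬⊑ForiginF m f p q
  ¬⊑ForiginF m ((l , node _ _) ∷ f) (here root) q ()
  ¬⊑ForiginF m ((l , node m′ f′) ∷ f) (here (down p)) (here x) = ¬⊑origin m′ f′ p x
  ¬⊑ForiginF m ((l , node _ _) ∷ f) (here (down p)) (there q) ()
  ¬⊑ForiginF m ((l , node _ _) ∷ f) (there p) (here x) ()
  ¬⊑ForiginF m ((l , node _ _) ∷ f) (there p) (there q) = ¬⊑ForiginF m f p q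

  TopF-originF : ∀ m f (p : PosF f) (q : PosF (cutForest m f p)) {l : Label} → TopF (cutForest m f p) q l →
    TopF f (originF m f p q) l
  TopF-originF m ((l , node _ _) ∷ f) (here root) q isTop = tt isTop
  TopF-originF m ((l , node _ _) ∷ f) (here (down p)) (here root) th = th
  TopF-originF m ((l , node _ _) ∷ f) (here (down p)) (there q) (tt isTop) = tt isTop
  TopF-originF m ((l , node _ _) ∷ f) (there p) (here q) th = th
  TopF-originF m ((l , node _ _) ∷ f) (there p) (there q) (tt isTop) = tt (TopF-originF m f p q isTop)

  Child-origin : ∀ m f (p : PosF f) (x y : Pos (cutTree m f p)) {l : Label} → Child (cutTree m f p) x y l →
    Child (node m f) (origin m f p x) (origin m f p y) l
  ChildF-originF : ∀ m f (p : PosF f) (q r : PosF (cutForest m f p)) {l : Label} →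
    ChildF (cutForest m f p) q r l → ChildF f (originF m f p q) (originF m f p r) l
  Child-origin m f p root (down q) (top isTop) = top (TopF-originF m f p q isTop)
  Child-origin m f p (down q) (down r) (inner c) = inner (ChildF-originF m f p q r c)
  ChildF-originF m ((l , node _ _) ∷ f) (here root) q r c = thereC c
  ChildF-originF m ((l , node m′ f′) ∷ f) (here (down p)) (here x) (here y) (hereC c) = hereC (Child-origin m′ f′ p x y c)
  ChildF-originF m ((l , node _ _) ∷ f) (here (down p)) (there q) (there r) (thereC c) = thereC c
  ChildF-originF m ((l , node _ _) ∷ f) (there p) (here x) (here y) (hereC c) = hereC c
  ChildF-originF m ((l , node _ _) ∷ f) (there p) (there q) (there r) (thereC c) = thereC (ChildF-originF m f p q r c)

  TopF-originF⁻¹ : ∀ m f (p : PosF f) (q : PosF (cutForest m f p)) {l : Label} → TopF f (originF m f p q) l →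
    TopF (cutForest m f p) q l
  TopF-originF⁻¹ m ((l , node _ _) ∷ f) (here root) q (tt isTop) = isTop
  TopF-originF⁻¹ m ((l , node _ _) ∷ f) (here (down p)) (here root) th = th
  TopF-originF⁻¹ m ((l , node _ _) ∷ f) (here (down p)) (here (down _)) ()
  TopF-originF⁻¹ m ((l , node _ _) ∷ f) (here (down p)) (there q) (tt isTop) = tt isTop
  TopF-originF⁻¹ m ((l , node _ _) ∷ f) (there p) (here q) th = th
  TopF-originF⁻¹ m ((l , node _ _) ∷ f) (there p) (there q) (tt isTop) = tt (TopF-originF⁻¹ m f p q isTop)

  Child-origin⁻¹ : ∀ m f (p : PosF f) (x y : Pos (cutTree m f p)) {l : Label} →
    Child (node m f) (origin m f p x) (origin m f p y) l → Child (cutTree m f p) x y l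
  ChildF-originF⁻¹ : ∀ m f (p : PosF f) (q r : PosF (cutForest m f p)) {l : Label} →
    ChildF f (originF m f p q) (originF m f p r) l → ChildF (cutForest m f p) q r l
  Child-origin⁻¹ m f p root (down q) (top isTop) = top (TopF-originF⁻¹ m f p q isTop)
  Child-origin⁻¹ m f p (down q) (down r) (inner c) = inner (ChildF-originF⁻¹ m f p q r c)
  ChildF-originF⁻¹ m ((l , node _ _) ∷ f) (here root) q r (thereC c) = c
  ChildF-originF⁻¹ m ((l , node m′ f′) ∷ f) (here (down p)) (here x) (here y) (hereC c) = hereC (Child-origin⁻¹ m′ f′ p x y c)
  ChildF-originF⁻¹ m ((l , node _ _) ∷ f) (here (down p)) (there q) (there r) (thereC c) = thereC c
  ChildF-originF⁻¹ m ((l , node _ _) ∷ f) (there p) (here x) (here y) (hereC c) = hereC c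
  ChildF-originF⁻¹ m ((l , node _ _) ∷ f) (there p) (there q) (there r) (thereC c) = thereC (ChildF-originF⁻¹ m f p q r c)

  marking-origin : ∀ m f (p : PosF f) (x : Pos (cutTree m f p)) →
    markingAt (cutTree m f p) x ≡ markingAt (node m f) (origin m f p x) ⊎ Σ Label (Child (node m f) (origin m f p x) (down p))
  markingF-originF : ∀ m f (p : PosF f) (q : PosF (cutForest m f p)) →
    markingAtF (cutForest m f p) q ≡ markingAtF f (originF m f p q) ⊎ Σ Label (ChildF f (originF m f p q) p)
  marking-origin m f p root = root-case f p
    where
    root-case : ∀ f (p : PosF f) → proj₁ (cutF m f p) ≡ m ⊎ Σ Label (Child (node m f) root (down p))
    root-case ((l , node _ _) ∷ f) (here root) = inj₂ (l , top th)
    root-case ((l , node _ _) ∷ f) (here (down p)) = inj₁ refl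
    root-case ((l , node _ _) ∷ f) (there p) with root-case f p
    ... | inj₁ e = inj₁ e
    ... | inj₂ (l₀ , top isTop) = inj₂ (l₀ , top (tt isTop))
  marking-origin m f p (down q) with markingF-originF m f p q
  ... | inj₁ e = inj₁ e
  ... | inj₂ (l₀ , c) = inj₂ (l₀ , inner c)
  markingF-originF m ((l , node _ _) ∷ f) (here root) q = inj₁ refl
  markingF-originF m ((l , node m′ f′) ∷ f) (here (down p)) (here x) with marking-origin m′ f′ p x
  ... | inj₁ e = inj₁ e
  ... | inj₂ (l₀ , c) = inj₂ (l₀ , hereC c)
  markingF-originF m ((l , node _ _) ∷ f) (here (down p)) (there q) = inj₁ refl
  markingF-originF m ((l , node _ _) ∷ f) (there p) (here x) = inj₁ refl
  markingF-originF m ((l , node _ _) ∷ f) (there p) (there q) with markingF-originF m f p q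
  ... | inj₁ e = inj₁ e
  ... | inj₂ (l₀ , c) = inj₂ (l₀ , thereC c)

  marking-parent : ∀ m f (p : PosF f) (x : Pos (cutTree m f p)) {l₀ : Label} →
    Child (node m f) (origin m f p x) (down p) l₀ →
    markingAt (cutTree m f p) x ≡ markingAt (node m f) (origin m f p x) +ᴹ proj₁ l₀
  markingF-parentF : ∀ m f (p : PosF f) (q : PosF (cutForest m f p)) {l₀ : Label} → ChildF f (originF m f p q) p l₀ →
    markingAtF (cutForest m f p) q ≡ markingAtF f (originF m f p q) +ᴹ proj₁ l₀
  marking-parent m f p root (top isTop) = root-case f p isTop
    where
    root-case : ∀ f (p : PosF f) {l₀ : Label} → TopF f p l₀ → proj₁ (cutF m f p) ≡ m +ᴹ proj₁ l₀
    root-case ((l , node _ _) ∷ f) (here root) th = refl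
    root-case ((l , node _ _) ∷ f) (there p) (tt isTop) = root-case f p isTop
  marking-parent m f p (down q) (inner c) = markingF-parentF m f p q c
  markingF-parentF m ((l , node _ _) ∷ f) (here root) q ()
  markingF-parentF m ((l , node m′ f′) ∷ f) (here (down p)) (here x) (hereC c) = marking-parent m′ f′ p x c
  markingF-parentF m ((l , node _ _) ∷ f) (here (down p)) (there q) ()
  markingF-parentF m ((l , node _ _) ∷ f) (there p) (here x) ()
  markingF-parentF m ((l , node _ _) ∷ f) (there p) (there q) (thereC c) = markingF-parentF m f p q c

  marking-origin-≤ : ∀ m f (p : PosF f) (x : Pos (cutTree m f p)) →
    markingAt (node m f) (origin m f p x) ≤ᴹ markingAt (cutTree m f p) x
  marking-origin-≤ m f p x q with marking-origin m f p x
  ... | inj₁ e rewrite e = ≤-refl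
  ... | inj₂ (l₀ , c) rewrite marking-parent m f p x c = m≤m+n _ _

  module CutEmbedding {m m′ : Marking} {fo fo′ : Forest} (p : PosF fo) (p′ : PosF fo′)
                      {f : Pos (node m fo) → Pos (node m′ fo′)} (emb : Embeds (node m fo) (node m′ fo′) f)
                      (fp≡p′ : f (down p) ≡ down p′) where
    private
      s₁ s₁′ : Tree
      s₁ = cutTree m fo p
      s₁′ = cutTree m′ fo′ p′

      o : Pos s₁ → Pos (node m fo)
      o = origin m fo p

      o′ : Pos s₁′ → Pos (node m′ fo′)
      o′ = origin m′ fo′ p′

      f-injective : Injective _≡_ _≡_ f
      f-injective = proj₁ emb

      f-marking : ∀ w → markingAt (node m fo) w ≤ᴹ markingAt (node m′ fo′) (f w)
      f-marking = proj₁ (proj₂ emb)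

      survivor : (x : Pos s₁) → Σ (Pos s₁′) (λ x′ → o′ x′ ≡ f (o x))
      survivor x with ⊒⊎origin m′ fo′ p′ (f (o x))
      ... | inj₁ p′⊑fx = ⊥-elim (¬⊑origin m fo p x
              (Embeds⇒⊑-reflecting emb (down p) (o x) (subst (_⊑ f (o x)) (sym fp≡p′) p′⊑fx)))
      ... | inj₂ x′ = x′

    map : Pos s₁ → Pos s₁′
    map x = proj₁ (survivor x)

    origin-map : ∀ x → o′ (map x) ≡ f (o x)
    origin-map x = proj₂ (survivor x)

    map-embeds : Embeds s₁ s₁′ map
    map-embeds = injective , marking-≤ , edges
      where
      injective : Injective _≡_ _≡_ map
      injective {x} {y} e = origin-injective m fo p (f-injective (begin
        f (o x)        ≡⟨ sym (origin-map x) ⟩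
        o′ (map x)     ≡⟨ cong o′ e ⟩
        o′ (map y)     ≡⟨ origin-map y ⟩
        f (o y)        ∎))
        where open ≡-Reasoning

      image : ∀ x y {l} → Child (node m fo) (o x) y l →
        Σ Label (λ l′ → Child (node m′ fo′) (o′ (map x)) (f y) l′ × (l ≤ᴸ l′))
      image x y c with proj₂ (proj₂ emb) _ _ _ c
      ... | l′ , c′ , l≤l′ = l′ , subst (λ z → Child (node m′ fo′) z (f y) l′) (sym (origin-map x)) c′ , l≤l′

      marking-f-origin-≤ : ∀ x → markingAt (node m′ fo′) (f (o x)) ≤ᴹ markingAt s₁′ (map x)
      marking-f-origin-≤ x =
        subst (λ z → markingAt (node m′ fo′) z ≤ᴹ markingAt s₁′ (map x)) (origin-map x) (marking-origin-≤ m′ fo′ p′ (map x))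

      marking-≤ : ∀ x → markingAt s₁ x ≤ᴹ markingAt s₁′ (map x)
      marking-≤ x q with marking-origin m fo p x
      ... | inj₁ unchanged rewrite unchanged = ≤-trans (f-marking (o x) q) (marking-f-origin-≤ x q)
      ... | inj₂ (l₀ , c) with image x (down p) c
      ... | l₀′ , c′ , l₀≤l₀′ rewrite marking-parent m fo p x c
            | marking-parent m′ fo′ p′ (map x) (subst (λ z → Child (node m′ fo′) (o′ (map x)) z l₀′) fp≡p′ c′)
            | origin-map x = +-mono-≤ (f-marking (o x) q) (l₀≤l₀′ q)

      edges : ∀ x y l → Child s₁ x y l → Σ Label (λ l′ → Child s₁′ (map x) (map y) l′ × (l ≤ᴸ l′))
      edges x y l c with image x (o y) (Child-origin m fo p x y c)
      ... | l′ , c′ , l≤l′ =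
        l′ , Child-origin⁻¹ m′ fo′ p′ (map x) (map y) (subst (λ z → Child (node m′ fo′) _ z l′) (sym (origin-map y)) c′) ,
        l≤l′

    map-root : f root ≡ root → map root ≡ root
    map-root f-root = origin-injective m′ fo′ p′ (trans (origin-map root) f-root)

  -- Firing

  mapAt-cong : ∀ {g g′ : Tree → Tree} → (∀ t → g t ≡ g′ t) → ∀ t v → mapAt t v g ≡ mapAt t v g′
  mapAtF-cong : ∀ {g g′ : Tree → Tree} → (∀ t → g t ≡ g′ t) → ∀ f p → mapAtF f p g ≡ mapAtF f p g′
  mapAt-cong g≗g′ t root = g≗g′ t
  mapAt-cong g≗g′ (node m f) (down p) = cong (node m) (mapAtF-cong g≗g′ f p)
  mapAtF-cong g≗g′ ((l , t) ∷ f) (here p) = cong (λ t′ → (l , t′) ∷ f) (mapAt-cong g≗g′ t p)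
  mapAtF-cong g≗g′ (x ∷ f) (there p) = cong (x ∷_) (mapAtF-cong g≗g′ f p)

  Simulates : {t t′ : Tree} → (Pos t → Pos t′) → State → State → Set
  Simulates {t} {t′} f s s′ = s ⪯ s′ × (f (rootOf t) ≡ rootOf t′ → s ⪯ᵣ s′)

  simulates : ∀ {t t′ u u′} {f : Pos t → Pos t′} (g : Pos u → Pos u′) → Embeds u u′ g →
              (f (rootOf t) ≡ rootOf t′ → g (rootOf u) ≡ rootOf u′) → Simulates f (tr u) (tr u′)
  simulates g emb g-root = (g , emb) , λ f-root → g , emb , g-root f-root

  elementaryEffect : Fin nEl → Marking → Marking
  elementaryEffect e m = (m ∸ᴹ W⁻ (inj₁ e)) +ᴹ W⁺ (inj₁ e)

  abstractEffect : Fin nAb → Marking → Marking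
  abstractEffect a m = m ∸ᴹ W⁻ (inj₂ (inj₁ a))

  elementaryEffect-monotone : ∀ e → Monotone (elementaryEffect e)
  elementaryEffect-monotone e m≤m′ q = +-mono-≤ (∸-monoˡ-≤ (W⁻ (inj₁ e) q) (m≤m′ q)) ≤-refl

  abstractEffect-monotone : ∀ a → Monotone (abstractEffect a)
  abstractEffect-monotone a m≤m′ q = ∸-monoˡ-≤ (W⁻ (inj₂ (inj₁ a)) q) (m≤m′ q)

  fire-elementary : ∀ t v e → fireResult t v (inj₁ e) ≡ tr (Relabel.relabelled (elementaryEffect e) t v)
  fire-elementary t v e = cong tr (mapAt-cong (λ { (node _ _) → refl }) t v)

  fire-abstract : ∀ t v a → fireResult t v (inj₂ (inj₁ a)) ≡
    tr (Sprout.sprouted (abLabel a) (Ω a) (Relabel.relabelled (abstractEffect a) t v) (Relabel.pos (abstractEffect a) t v v))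
  fire-abstract t v a = cong tr (trans (mapAt-cong (λ { (node _ _) → refl }) t v)
                                       (Relabel.mapAt-∘-relabel (abstractEffect a) (sprout (abLabel a) (Ω a)) t v))

  fire-simulated : ∀ {t t′} {f : Pos t → Pos t′} → Embeds t t′ f → ∀ v τ →
    Simulates f (fireResult t v τ) (fireResult t′ (f v) τ)
  fire-simulated {t} {t′} {f} emb v (inj₁ e) =
    subst₂ (Simulates f) (sym (fire-elementary t v e)) (sym (fire-elementary t′ (f v) e))
      (simulates {f = f} map map-embeds map-rootOf)
    where open Relabel.Embedding (elementaryEffect e) (elementaryEffect-monotone e) emb v
  fire-simulated {t} {t′} {f} emb v (inj₂ (inj₁ a)) =
    subst₂ (Simulates f) (sym (fire-abstract t v a)) (sym (fire-abstract t′ (f v) a))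
      (subst (Simulates f (tr (sprouted (relabelled t v) (pos t v v))) ∘ tr ∘ sprouted (relabelled t′ (f v))) (R.map-pos v)
        (simulates {f = f} S.map S.map-embeds (S.map-rootOf ∘ R.map-rootOf)))
    where
    open Relabel (abstractEffect a) using (relabelled; pos)
    open Sprout (abLabel a) (Ω a) using (sprouted)
    module R = Relabel.Embedding (abstractEffect a) (abstractEffect-monotone a) emb v
    module S = Sprout.Embedding (abLabel a) (Ω a) R.map-embeds (pos t v v)
  fire-simulated {node _ _} {t′@(node _ _)} emb root (inj₂ (inj₂ _)) = tt , λ f-root → cong (cutAt t′) f-root
  fire-simulated {node m fo} {node m′ fo′} {f} emb (down p) (inj₂ (inj₂ _)) with f (down p) in fp≡
  ... | root = ⊥-elim (Embeds⇒⊑-reflecting emb (down p) root (subst (_⊑ f root) (sym fp≡) tt))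
  ... | down p′ = simulates {f = f} map map-embeds map-root
    where open CutEmbedding p p′ emb fp≡

  fire-image : ∀ {t t′} {f : Pos t → Pos t′} → Embeds t t′ f → ∀ {v τ s₁} → Fires (tr t) v τ s₁ →
               Σ State (λ s₁′ → Fires (tr t′) (f v) τ s₁′ × Simulates f s₁ s₁′)
  fire-image {t′ = t′} {f} emb {v} {τ} (enabled , refl) =
    fireResult t′ (f v) τ , ((λ q → ≤-trans (enabled q) (proj₁ (proj₂ emb) v q)) , refl) , fire-simulated emb v τ

  ⪯-stronglyCompatible : StronglyCompatible _⪯_
  ⪯-stronglyCompatible (tr t) (tr t′) (f , emb) v τ _ fires with fire-image emb fires
  ... | s₁′ , fires′ , s₁⪯s₁′ , _ = f v , τ , s₁′ , fires′ , s₁⪯s₁′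

  ⪯ᵣ-stronglyCompatible : StronglyCompatible _⪯ᵣ_
  ⪯ᵣ-stronglyCompatible (tr t) (tr t′) (f , emb , f-root) v τ _ fires with fire-image emb fires
  ... | s₁′ , fires′ , _ , s₁⪯ᵣs₁′ = f v , τ , s₁′ , fires′ , s₁⪯ᵣs₁′ f-root

lemma2 : (N : RPN) →
    RPNDefs.StronglyCompatible N (RPNDefs._⪯_ N) × RPNDefs.StronglyCompatible N (RPNDefs._⪯ᵣ_ N)
lemma2 N = ⪯-stronglyCompatible , ⪯ᵣ-stronglyCompatible
  where open Compatibility N
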